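{- Let $d\ge1$ and let $f\in\mathbb{F}\langle X\rangle$ be an s-polynomial (with parameter $d$) in the variables $x_1,\dots,x_n$. If there exist vectors of polynomials $\overline{P_1},\dots,\overline{P_r}\in\mathbb{F}\langle X\rangle^{2d}$ with $f\in\langle S_{2d}(\overline{P_1}),\dots,S_{2d}(\overline{P_r})\rangle$, then there are constants $c_1,\dots,c_r\in\mathbb{F}$ such that $f=\sum_{i=1}^r c_i\,S_{2d}\big(\overline{P_i}^{(1)}\big)$.
   Context: $\mathbb{F}$ is a field of characteristic $0$ and $\mathbb{F}\langle X\rangle$ is the free associative algebra of non-commutative polynomials over $\mathbb{F}$ in variables $X=\{x_1,x_2,\dots\}$. $\langle g_1,\dots,g_r\rangle$ is the two-sided ideal generated. $S_{m}(x_1,\dots,x_m)=\sum_{\sigma\in\mathcal{S}_m}\mathrm{sgn}(\sigma)x_{\sigma(1)}\cdots x_{\sigma(m)}$ is the standard polynomial; for a vector $\overline{P}=(P_1,\dots,P_{2d})$, $S_{2d}(\overline P)=S_{2d}(P_1,\dots,P_{2d})$. For a polynomial $g$, $g^{(j)}$ is its homogeneous part of total degree $j$ (the sum of its monomials of total degree $j$); for a vector, $\overline{P}^{(1)}$ is taken coordinatewise. An s-polynomial in $x_1,\dots,x_n$ is a polynomial of the form $\sum_{j_1<j_2<\dots<j_{2d}\in[n]}c_{j_1\dots j_{2d}}S_{2d}(x_{j_1},\dots,x_{j_{2d}})$ with all $c_{j_1\dots j_{2d}}\in\{0,1\}$. -}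

module Defs where

open import Level using (Level; _⊔_)
open import Algebra.Bundles using (CommutativeRing)
open import Data.Nat as ℕ using (ℕ; zero; suc; _<ᵇ_)
open import Data.Bool using (Bool; true; false; if_then_else_)
open import Data.Fin as Fin using (Fin; toℕ)
open import Data.List as List using (List; []; _∷_; _++_; map; concatMap; length; filter; allFin)
import Data.List.Properties as ListP
open import Data.Vec as Vec using (Vec; []; _∷_; lookup)
open import Data.Product using (Σ; ∃; _×_; _,_; proj₁; proj₂)
open import Relation.Nullary using (¬_; yes; no)
open import Relation.Nullary.Decidable using (⌊_⌋)
open import Relation.Binary.PropositionalEquality using (_≡_)

module _ {c ℓ : Level} (R : CommutativeRing c ℓ) where
  open CommutativeRing R

  natToR : ℕ → Carrier
  natToR zero    = 0#
  natToR (suc n) = 1# + natToR n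

  record IsField : Set (c ⊔ ℓ) where
    field
      1≉0     : ¬ (1# ≈ 0#)
      inverse : ∀ x → ¬ (x ≈ 0#) → ∃ λ y → x * y ≈ 1#

  CharZero : Set ℓ
  CharZero = ∀ n → ¬ (natToR (suc n) ≈ 0#)

picks : ∀ {a} {A : Set a} → List A → List (A × List A)
picks []       = []
picks (x ∷ xs) = (x , xs) ∷ map (λ { (y , ys) → (y , x ∷ ys) }) (picks xs)

permsN : ∀ {a} {A : Set a} → ℕ → List A → List (List A)
permsN zero    _  = [] ∷ []
permsN (suc k) xs = concatMap (λ { (y , ys) → map (y ∷_) (permsN k ys) }) (picks xs)

perms : ∀ {a} {A : Set a} → List A → List (List A)
perms xs = permsN (length xs) xs

inversions : ∀ {m} → List (Fin m) → ℕ
inversions []       = 0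
inversions (i ∷ is) =
  length (filter (λ j → Data.Bool.T? (toℕ j <ᵇ toℕ i)) is) ℕ.+ inversions is
  where import Data.Bool

even : ℕ → Bool
even zero          = true
even (suc zero)    = false
even (suc (suc n)) = even n

choose : ∀ {a} {A : Set a} (k : ℕ) → List A → List (Vec A k)
choose zero    _        = [] ∷ []
choose (suc k) []       = []
choose (suc k) (x ∷ xs) = map (x ∷_) (choose k xs) ++ choose (suc k) xs

-- The free associative algebra F⟨X⟩, X = {x_0, x_1, ...} (indexed by ℕ),
-- represented as finite formal sums of coefficient·monomial, up to the
-- equality "all coefficients agree".

Word : Set
Word = List ℕ

module FreeAlg {c ℓ : Level} (R : CommutativeRing c ℓ) where
  open CommutativeRing R

  Poly : Set c
  Poly = List (Carrier × Word)

  coeff : Poly → Word → Carrier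
  coeff []             w = 0#
  coeff ((a , u) ∷ p) w with ListP.≡-dec ℕ._≟_ u w
  ... | yes _ = a + coeff p w
  ... | no  _ = coeff p w

  infix 4 _≃_
  _≃_ : Poly → Poly → Set ℓ
  p ≃ q = ∀ w → coeff p w ≈ coeff q w

  zeroP : Poly
  zeroP = []

  oneP : Poly
  oneP = (1# , []) ∷ []

  var : ℕ → Poly
  var i = (1# , i ∷ []) ∷ []

  infixl 6 _⊕_
  _⊕_ : Poly → Poly → Poly
  _⊕_ = _++_

  infixl 7 _⊗_
  _⊗_ : Poly → Poly → Poly
  p ⊗ q = concatMap (λ { (a , u) → map (λ { (b , v) → (a * b , u ++ v) }) q }) p

  infixr 7 _·_
  _·_ : Carrier → Poly → Poly
  k · p = map (λ { (a , u) → (k * a , u) }) p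

  negP : Poly → Poly
  negP p = (- 1#) · p

  sumP : List Poly → Poly
  sumP = List.foldr _⊕_ zeroP

  prodP : List Poly → Poly
  prodP = List.foldr _⊗_ oneP

  homPart : ℕ → Poly → Poly
  homPart j p = filter (λ t → length (proj₂ t) ℕ.≟ j) p

  -- standard polynomial S_m(P_1,…,P_m) = Σ_{σ∈S_m} sgn(σ) P_{σ(1)}⋯P_{σ(m)}
  -- (σ ranges over all orderings of allFin m; sgn σ = (-1)^{#inversions})
  standard : ∀ {m} → Vec Poly m → Poly
  standard {m} P = sumP (map term (perms (allFin m)))
    where
    term : List (Fin m) → Poly
    term σ = (if even (inversions σ) then 1# else - 1#)
             · prodP (map (lookup P) σ)

  -- two-sided ideal generated by g_1,…,g_r : f = Σ_k a_k g_{i_k} b_k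
  InIdeal : ∀ {r} → (Fin r → Poly) → Poly → Set (c ⊔ ℓ)
  InIdeal {r} g f = Σ (List (Poly × Fin r × Poly)) λ ts →
    f ≃ sumP (map (λ { (a , i , b) → a ⊗ g i ⊗ b }) ts)

  -- s-polynomial with parameter d in the variables x_1,…,x_n
  -- (variables x_1,…,x_n are var 0,…,var (n-1)); coefficients in {0,1}
  IsSPoly : ℕ → ℕ → Poly → Set ℓ
  IsSPoly d n f = Σ (Vec (Fin n) (2 ℕ.* d) → Bool) λ cf →
    f ≃ sumP (map (λ js → if cf js then standard (Vec.map (λ j → var (toℕ j)) js)
                                   else zeroP)
                  (choose (2 ℕ.* d) (allFin n)))

module Submission where

-- Let S = S_{2d}(P_1,…,P_{2d}) with arbitrary P_i ∈ F⟨X⟩, and let P⁽¹⁾ be the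
-- vector of linear parts.  The heart of the proof is the LOW-DEGREE LEMMA:
-- S and S(P⁽¹⁾) have the same coefficient on every word of length ≤ 2d.
-- Since S(P⁽¹⁾) is homogeneous of degree 2d, every element of the ideal
-- generated by S = S(P⁽¹⁾) + (degree > 2d) has as degree-2d part
-- Σ a_k(∅) S(P⁽¹⁾) b_k(∅), the a_k(∅), b_k(∅) being constant terms; an
-- s-polynomial is homogeneous of degree 2d, which gives the constants c_i.
--
-- The low-degree lemma is proved by expanding S along its first letter,
-- S(p;xs) = Σ_{y ∈ xs} ± p_y · S(p; xs∖y), and by a simultaneous induction:
-- for an even number of arguments the coefficients on short words agree
-- with those of the linear parts, for an odd number they differ exactly by
-- the "constant first factor" terms.  The even case uses that these terms
-- form a double sum Σ_{y≠z} ± F(y,z) that is antisymmetric in (y,z), hence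
-- vanishes because 2 is invertible (characteristic 0).

open import Defs
open import Level using (Level)
open import Algebra.Bundles using (CommutativeRing)
open import Data.Nat as ℕ using (ℕ; zero; suc; _≤_; _<_; _<ᵇ_; z≤n; s≤s)
import Data.Nat.Properties as ℕP
import Algebra.Properties.CommutativeSemigroup ℕP.+-commutativeSemigroup as ℕ+
open import Data.Bool using (Bool; true; false; if_then_else_; T)
open import Data.Bool.Properties using (T?)
open import Data.Fin as Fin using (Fin; toℕ)
import Data.Fin.Properties as FinP
open import Data.List as List using (List; []; _∷_; _++_; map; concatMap; length; filter; allFin)
import Data.List.Properties as ListP
open import Data.List.Membership.Propositional using (_∈_)
open import Data.List.Membership.Propositional.Properties using (∈-map⁺; ∈-map⁻; ∈-concat⁻′)
open import Data.List.Relation.Unary.Any using (here; there)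
open import Data.List.Relation.Unary.All as All using (All; []; _∷_)
import Data.List.Relation.Unary.All.Properties as AllP
open import Data.List.Relation.Unary.AllPairs using (_∷_)
open import Data.List.Relation.Unary.Unique.Propositional using (Unique)
open import Data.List.Relation.Unary.Unique.Propositional.Properties using (allFin⁺)
open import Data.Vec as Vec using (Vec; lookup)
import Data.Vec.Properties as VecP
open import Data.Sum using (_⊎_; inj₁; inj₂)
open import Data.Product using (Σ; ∃; _×_; _,_; proj₁; proj₂)
open import Data.Empty using (⊥-elim)
open import Relation.Nullary using (¬_; Dec; yes; no)
open import Function using (_∘_)
open import Relation.Binary.PropositionalEquality as Eq using (_≡_; _≢_)

-- Combinatorics of picks and permutations (independent of the ring)

_≺_ : ∀ {m} → Fin m → Fin m → Bool
x ≺ y = toℕ x <ᵇ toℕ y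

bit : Bool → ℕ
bit true  = 1
bit false = 0

-- Number of entries of ys smaller than y; by definition
-- inversions (y ∷ ys) = #below ys y + inversions ys.
#below : ∀ {m} → List (Fin m) → Fin m → ℕ
#below ys y = length (filter (λ j → T? (toℕ j <ᵇ toℕ y)) ys)

#below-∷ : ∀ {m} (x : Fin m) ys y → #below (x ∷ ys) y ≡ bit (x ≺ y) ℕ.+ #below ys y
#below-∷ x ys y with toℕ x <ᵇ toℕ y
... | true  = Eq.refl
... | false = Eq.refl

module _ {m : ℕ} where

  Pick : Set
  Pick = Fin m × List (Fin m)

  picks-∷⁻ : ∀ x (xs : List (Fin m)) {s : Pick} → s ∈ picks (x ∷ xs) →
    s ≡ (x , xs) ⊎ Σ Pick λ s′ → s′ ∈ picks xs × s ≡ (proj₁ s′ , x ∷ proj₂ s′)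
  picks-∷⁻ x xs (here e)   = inj₁ e
  picks-∷⁻ x xs (there s∈) with ∈-map⁻ (λ { (y , ys) → (y , x ∷ ys) }) s∈
  ... | s′ , s′∈ , e = inj₂ (s′ , s′∈ , e)

  picks-length : ∀ (xs : List (Fin m)) {s : Pick} → s ∈ picks xs →
                 length xs ≡ suc (length (proj₂ s))
  picks-length (x ∷ xs) s∈ with picks-∷⁻ x xs s∈
  ... | inj₁ Eq.refl               = Eq.refl
  ... | inj₂ (s′ , s′∈ , Eq.refl) = Eq.cong suc (picks-length xs s′∈)

  picks-#below : ∀ (xs : List (Fin m)) {s : Pick} → s ∈ picks xs → ∀ z →
                 #below xs z ≡ bit (proj₁ s ≺ z) ℕ.+ #below (proj₂ s) z
  picks-#below (x ∷ xs) s∈ z with picks-∷⁻ x xs s∈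
  ... | inj₁ Eq.refl = #below-∷ x xs z
  ... | inj₂ ((y , ys) , s′∈ , Eq.refl) = begin
      #below (x ∷ xs) z                               ≡⟨ #below-∷ x xs z ⟩
      bit (x ≺ z) ℕ.+ #below xs z                     ≡⟨ Eq.cong (bit (x ≺ z) ℕ.+_) (picks-#below xs s′∈ z) ⟩
      bit (x ≺ z) ℕ.+ (bit (y ≺ z) ℕ.+ #below ys z)   ≡⟨ ℕ+.x∙yz≈y∙xz (bit (x ≺ z)) (bit (y ≺ z)) (#below ys z) ⟩
      bit (y ≺ z) ℕ.+ (bit (x ≺ z) ℕ.+ #below ys z)   ≡⟨ Eq.cong (bit (y ≺ z) ℕ.+_) (#below-∷ x ys z) ⟨
      bit (y ≺ z) ℕ.+ #below (x ∷ ys) z               ∎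
    where open Eq.≡-Reasoning

  picks-chosen∈ : ∀ (xs : List (Fin m)) {s : Pick} → s ∈ picks xs → proj₁ s ∈ xs
  picks-chosen∈ (x ∷ xs) s∈ with picks-∷⁻ x xs s∈
  ... | inj₁ Eq.refl               = here Eq.refl
  ... | inj₂ (s′ , s′∈ , Eq.refl) = there (picks-chosen∈ xs s′∈)

  picks-rest⊆ : ∀ (xs : List (Fin m)) {s : Pick} → s ∈ picks xs → ∀ {z} → z ∈ proj₂ s → z ∈ xs
  picks-rest⊆ (x ∷ xs) s∈ z∈ with picks-∷⁻ x xs s∈
  ... | inj₁ Eq.refl = there z∈
  picks-rest⊆ (x ∷ xs) s∈ (here e)  | inj₂ (s′ , s′∈ , Eq.refl) = here e
  picks-rest⊆ (x ∷ xs) s∈ (there z∈) | inj₂ (s′ , s′∈ , Eq.refl) = there (picks-rest⊆ xs s′∈ z∈)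

  picks-unique : ∀ (xs : List (Fin m)) {s : Pick} → s ∈ picks xs → Unique xs → Unique (proj₂ s)
  picks-unique (x ∷ xs) s∈ (x∉ ∷ u) with picks-∷⁻ x xs s∈
  ... | inj₁ Eq.refl = u
  ... | inj₂ (s′ , s′∈ , Eq.refl) =
    All.tabulate (λ z∈ → All.lookup x∉ (picks-rest⊆ xs s′∈ z∈)) ∷ picks-unique xs s′∈ u

  picks-chosen∉ : ∀ (xs : List (Fin m)) {s : Pick} → s ∈ picks xs → Unique xs →
                  All (proj₁ s ≢_) (proj₂ s)
  picks-chosen∉ (x ∷ xs) s∈ (x∉ ∷ u) with picks-∷⁻ x xs s∈
  ... | inj₁ Eq.refl = x∉
  ... | inj₂ (s′ , s′∈ , Eq.refl) =
    (λ e → All.lookup x∉ (picks-chosen∈ xs s′∈) (Eq.sym e)) ∷ picks-chosen∉ xs s′∈ u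

  permsN-suc⁻ : ∀ k (ys : List (Fin m)) {σ} → σ ∈ permsN (suc k) ys →
    Σ Pick λ s → s ∈ picks ys × Σ (List (Fin m)) λ τ → τ ∈ permsN k (proj₂ s) × σ ≡ proj₁ s ∷ τ
  permsN-suc⁻ k ys σ∈ with ∈-concat⁻′ (map (λ { (y , ys′) → map (y ∷_) (permsN k ys′) }) (picks ys)) σ∈
  ... | l , σ∈l , l∈ with ∈-map⁻ (λ { (y , ys′) → map (y ∷_) (permsN k ys′) }) l∈
  ...   | s , s∈ , Eq.refl with ∈-map⁻ (proj₁ s ∷_) σ∈l
  ...     | τ , τ∈ , e = s , s∈ , τ , τ∈ , e

  permsN-length : ∀ k (ys : List (Fin m)) {σ} → σ ∈ permsN k ys → length σ ≡ k
  permsN-length zero    ys (here Eq.refl) = Eq.refl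
  permsN-length (suc k) ys σ∈ with permsN-suc⁻ k ys σ∈
  ... | s , s∈ , τ , τ∈ , Eq.refl = Eq.cong suc (permsN-length k (proj₂ s) τ∈)

  perms-#below : ∀ k (ys : List (Fin m)) {σ} → σ ∈ permsN k ys → k ≡ length ys →
                 ∀ z → #below σ z ≡ #below ys z
  perms-#below zero    []       (here Eq.refl) _ z = Eq.refl
  perms-#below (suc k) ys σ∈ k≡ z with permsN-suc⁻ k ys σ∈
  ... | s , s∈ , τ , τ∈ , Eq.refl = begin
      #below (proj₁ s ∷ τ) z                        ≡⟨ #below-∷ (proj₁ s) τ z ⟩
      bit (proj₁ s ≺ z) ℕ.+ #below τ z
        ≡⟨ Eq.cong (bit (proj₁ s ≺ z) ℕ.+_) (perms-#below k (proj₂ s) τ∈ k≡′ z) ⟩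
      bit (proj₁ s ≺ z) ℕ.+ #below (proj₂ s) z      ≡⟨ picks-#below ys s∈ z ⟨
      #below ys z                                   ∎
    where
    open Eq.≡-Reasoning
    k≡′ : k ≡ length (proj₂ s)
    k≡′ = ℕP.suc-injective (Eq.trans k≡ (picks-length ys s∈))

module Development {c ℓ : Level} (R : CommutativeRing c ℓ) where
  open CommutativeRing R
  open import Algebra.Properties.Ring ring using (-‿involutive; -‿+-comm; -‿distribˡ-*; -0#≈0#)
  open import Algebra.Properties.CommutativeSemigroup +-commutativeSemigroup using (interchange)
  open import Algebra.Properties.CommutativeSemigroup *-commutativeSemigroup
    using (x∙yz≈y∙xz; xy∙z≈xz∙y) renaming (interchange to *-interchange)
  open import Relation.Binary.Reasoning.Setoid setoid
  open FreeAlg R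

  ∑ : ∀ {a} {A : Set a} → List A → (A → Carrier) → Carrier
  ∑ []       f = 0#
  ∑ (x ∷ xs) f = f x + ∑ xs f

  syntax ∑ xs (λ x → e) = ∑[ x ← xs ] e

  private variable
    a b : Level
    A : Set a
    B : Set b

  ∑-cong : ∀ (xs : List A) {f g : A → Carrier} → (∀ {x} → x ∈ xs → f x ≈ g x) → ∑ xs f ≈ ∑ xs g
  ∑-cong []       h = refl
  ∑-cong (x ∷ xs) h = +-cong (h (here Eq.refl)) (∑-cong xs (λ x∈ → h (there x∈)))

  ∑-cong′ : ∀ (xs : List A) {f g : A → Carrier} → (∀ x → f x ≈ g x) → ∑ xs f ≈ ∑ xs g
  ∑-cong′ xs h = ∑-cong xs (λ {x} _ → h x)

  ∑-zero : ∀ (xs : List A) (f : A → Carrier) → (∀ {x} → x ∈ xs → f x ≈ 0#) → ∑ xs f ≈ 0#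
  ∑-zero []       f h = refl
  ∑-zero (x ∷ xs) f h =
    trans (+-cong (h (here Eq.refl)) (∑-zero xs f (λ x∈ → h (there x∈)))) (+-identityˡ 0#)

  ∑-++ : ∀ (xs ys : List A) (f : A → Carrier) → ∑ (xs ++ ys) f ≈ ∑ xs f + ∑ ys f
  ∑-++ []       ys f = sym (+-identityˡ _)
  ∑-++ (x ∷ xs) ys f = trans (+-congˡ (∑-++ xs ys f)) (sym (+-assoc _ _ _))

  ∑-+ : ∀ (xs : List A) (f g : A → Carrier) → ∑[ x ← xs ] (f x + g x) ≈ ∑ xs f + ∑ xs g
  ∑-+ []       f g = sym (+-identityˡ _)
  ∑-+ (x ∷ xs) f g = trans (+-congˡ (∑-+ xs f g)) (interchange _ _ _ _)

  ∑-neg : ∀ (xs : List A) (f : A → Carrier) → ∑[ x ← xs ] (- f x) ≈ - ∑ xs f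
  ∑-neg []       f = sym -0#≈0#
  ∑-neg (x ∷ xs) f = trans (+-congˡ (∑-neg xs f)) (-‿+-comm _ _)

  ∑-*ˡ : ∀ k (xs : List A) (f : A → Carrier) → k * ∑ xs f ≈ ∑[ x ← xs ] (k * f x)
  ∑-*ˡ k []       f = zeroʳ k
  ∑-*ˡ k (x ∷ xs) f = trans (distribˡ k _ _) (+-congˡ (∑-*ˡ k xs f))

  ∑-*ʳ : ∀ k (xs : List A) (f : A → Carrier) → ∑ xs f * k ≈ ∑[ x ← xs ] (f x * k)
  ∑-*ʳ k []       f = zeroˡ k
  ∑-*ʳ k (x ∷ xs) f = trans (distribʳ k _ _) (+-congˡ (∑-*ʳ k xs f))

  ∑-map : (h : A → B) (xs : List A) (f : B → Carrier) →
          ∑ (map h xs) f ≡ ∑[ x ← xs ] f (h x)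
  ∑-map h []       f = Eq.refl
  ∑-map h (x ∷ xs) f = Eq.cong (f (h x) +_) (∑-map h xs f)

  ∑-concatMap : (h : A → List B) (xs : List A) (f : B → Carrier) →
                ∑ (concatMap h xs) f ≈ ∑[ x ← xs ] ∑ (h x) f
  ∑-concatMap h []       f = refl
  ∑-concatMap h (x ∷ xs) f = trans (∑-++ (h x) (concatMap h xs) f) (+-congˡ (∑-concatMap h xs f))

  ∑-swap : (xs : List A) (ys : List B) (g : A → B → Carrier) →
           ∑[ x ← xs ] ∑ ys (g x) ≈ ∑[ y ← ys ] ∑[ x ← xs ] g x y
  ∑-swap []       ys g = sym (∑-zero ys _ (λ _ → refl))
  ∑-swap (x ∷ xs) ys g =
    trans (+-congˡ (∑-swap xs ys g)) (sym (∑-+ ys (g x) (λ y → ∑[ x′ ← xs ] g x′ y)))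

  -- Coefficients of sums, scalar multiples and products

  -- Kronecker delta on words, decided as in the definition of coeff.
  δ : Word → Word → Carrier
  δ u w with ListP.≡-dec ℕ._≟_ u w
  ... | yes _ = 1#
  ... | no  _ = 0#

  δ-refl : ∀ u → δ u u ≈ 1#
  δ-refl u with ListP.≡-dec ℕ._≟_ u u
  ... | yes _   = refl
  ... | no  u≢u = ⊥-elim (u≢u Eq.refl)

  δ-≢ : ∀ u w → u ≢ w → δ u w ≈ 0#
  δ-≢ u w u≢w with ListP.≡-dec ℕ._≟_ u w
  ... | yes u≡w = ⊥-elim (u≢w u≡w)
  ... | no  _   = refl

  δ-∷ : ∀ x u v → δ (x ∷ u) (x ∷ v) ≈ δ u v
  δ-∷ x u v = byCases (ListP.≡-dec ℕ._≟_ u v)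
    where
    byCases : Dec (u ≡ v) → δ (x ∷ u) (x ∷ v) ≈ δ u v
    byCases (yes u≡v) = Eq.subst (λ v′ → δ (x ∷ u) (x ∷ v′) ≈ δ u v′) u≡v
                                 (trans (δ-refl (x ∷ u)) (sym (δ-refl u)))
    byCases (no u≢v)  = trans (δ-≢ (x ∷ u) (x ∷ v) (u≢v ∘ ListP.∷-injectiveʳ)) (sym (δ-≢ u v u≢v))

  coeff-∷ : ∀ a u p w → coeff ((a , u) ∷ p) w ≈ a * δ u w + coeff p w
  coeff-∷ a u p w with ListP.≡-dec ℕ._≟_ u w
  ... | yes _ = +-congʳ (sym (*-identityʳ a))
  ... | no  _ = sym (trans (+-congʳ (zeroʳ a)) (+-identityˡ _))

  coeff-++ : ∀ p q w → coeff (p ++ q) w ≈ coeff p w + coeff q w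
  coeff-++ []            q w = sym (+-identityˡ _)
  coeff-++ ((a , u) ∷ p) q w = begin
    coeff ((a , u) ∷ (p ++ q)) w             ≈⟨ coeff-∷ a u (p ++ q) w ⟩
    a * δ u w + coeff (p ++ q) w             ≈⟨ +-congˡ (coeff-++ p q w) ⟩
    a * δ u w + (coeff p w + coeff q w)      ≈⟨ +-assoc _ _ _ ⟨
    (a * δ u w + coeff p w) + coeff q w      ≈⟨ +-congʳ (coeff-∷ a u p w) ⟨
    coeff ((a , u) ∷ p) w + coeff q w        ∎

  coeff-sumP : ∀ {a} {A : Set a} (h : A → Poly) (xs : List A) w →
               coeff (sumP (map h xs)) w ≈ ∑[ x ← xs ] coeff (h x) w
  coeff-sumP h []       w = refl
  coeff-sumP h (x ∷ xs) w = trans (coeff-++ (h x) _ w) (+-congˡ (coeff-sumP h xs w))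

  coeff-· : ∀ k p w → coeff (k · p) w ≈ k * coeff p w
  coeff-· k []            w = sym (zeroʳ k)
  coeff-· k ((a , u) ∷ p) w = begin
    coeff ((k * a , u) ∷ (k · p)) w          ≈⟨ coeff-∷ (k * a) u (k · p) w ⟩
    k * a * δ u w + coeff (k · p) w          ≈⟨ +-cong (*-assoc _ _ _) (coeff-· k p w) ⟩
    k * (a * δ u w) + k * coeff p w          ≈⟨ distribˡ _ _ _ ⟨
    k * (a * δ u w + coeff p w)              ≈⟨ *-congˡ (coeff-∷ a u p w) ⟨
    k * coeff ((a , u) ∷ p) w                ∎

  -- The cuts w = u ++ v of a word: splits⁺ lists those with a nonempty prefix.
  extendPrefix : ℕ → Word × Word → Word × Word
  extendPrefix x (u , v) = (x ∷ u , v)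

  mutual
    splits : Word → List (Word × Word)
    splits w = ([] , w) ∷ splits⁺ w

    splits⁺ : Word → List (Word × Word)
    splits⁺ []      = []
    splits⁺ (x ∷ w) = map (extendPrefix x) (splits w)

  splits⁺-nonempty : ∀ w {s} → s ∈ splits⁺ w → [] ≢ proj₁ s
  splits⁺-nonempty (x ∷ w) s∈ with ∈-map⁻ (extendPrefix x) s∈
  ... | _ , _ , Eq.refl = λ ()

  ∑-splits-δ : ∀ u v w → ∑[ s ← splits w ] (δ u (proj₁ s) * δ v (proj₂ s)) ≈ δ (u ++ v) w
  ∑-splits-δ []      v w = begin
    δ [] [] * δ v w + ∑[ s ← splits⁺ w ] (δ [] (proj₁ s) * δ v (proj₂ s))
      ≈⟨ +-cong (trans (*-congʳ (δ-refl [])) (*-identityˡ _)) (∑-zero (splits⁺ w) _ prefixNonempty) ⟩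
    δ v w + 0#
      ≈⟨ +-identityʳ _ ⟩
    δ v w ∎
    where
    prefixNonempty : ∀ {s} → s ∈ splits⁺ w → δ [] (proj₁ s) * δ v (proj₂ s) ≈ 0#
    prefixNonempty {s} s∈ = trans (*-congʳ (δ-≢ [] (proj₁ s) (splits⁺-nonempty w s∈))) (zeroˡ _)
  ∑-splits-δ (y ∷ u) v []      =
    trans (+-identityʳ _) (trans (*-congʳ (δ-≢ (y ∷ u) [] (λ ()))) (trans (zeroˡ _) (sym (δ-≢ (y ∷ u ++ v) [] (λ ())))))
  ∑-splits-δ (y ∷ u) v (x ∷ w) = begin
    δ (y ∷ u) [] * δ v (x ∷ w) + ∑ (map (extendPrefix x) (splits w)) term
      ≈⟨ +-cong (trans (*-congʳ (δ-≢ (y ∷ u) [] (λ ()))) (zeroˡ _)) (reflexive (∑-map (extendPrefix x) (splits w) term)) ⟩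
    0# + ∑[ s ← splits w ] (δ (y ∷ u) (x ∷ proj₁ s) * δ v (proj₂ s))
      ≈⟨ +-identityˡ _ ⟩
    ∑[ s ← splits w ] (δ (y ∷ u) (x ∷ proj₁ s) * δ v (proj₂ s))
      ≈⟨ firstLetter (y ℕ.≟ x) ⟩
    δ (y ∷ u ++ v) (x ∷ w) ∎
    where
    term : Word × Word → Carrier
    term s = δ (y ∷ u) (proj₁ s) * δ v (proj₂ s)
    firstLetter : Dec (y ≡ x) →
      ∑[ s ← splits w ] (δ (y ∷ u) (x ∷ proj₁ s) * δ v (proj₂ s)) ≈ δ (y ∷ u ++ v) (x ∷ w)
    firstLetter (yes Eq.refl) =
      trans (∑-cong′ (splits w) (λ s → *-congʳ (δ-∷ y u (proj₁ s))))
            (trans (∑-splits-δ u v w) (sym (δ-∷ y (u ++ v) w)))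
    firstLetter (no y≢x) =
      trans (∑-zero (splits w) _ (λ {s} _ → trans (*-congʳ (δ-≢ (y ∷ u) (x ∷ proj₁ s) (y≢x ∘ ListP.∷-injectiveˡ))) (zeroˡ _)))
            (sym (δ-≢ (y ∷ u ++ v) (x ∷ w) (y≢x ∘ ListP.∷-injectiveˡ)))

  coeff-shift : ∀ a u (h : Carrier × Word → Carrier × Word) →
    (∀ t → h t ≡ (a * proj₁ t , u ++ proj₂ t)) → ∀ q w →
    coeff (map h q) w ≈ ∑[ s ← splits w ] (a * δ u (proj₁ s) * coeff q (proj₂ s))
  coeff-shift a u h h≡ []            w = sym (∑-zero (splits w) _ (λ _ → zeroʳ _))
  coeff-shift a u h h≡ ((b , v) ∷ q) w rewrite h≡ (b , v) = begin
    coeff ((a * b , u ++ v) ∷ map h q) w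
      ≈⟨ coeff-∷ (a * b) (u ++ v) (map h q) w ⟩
    a * b * δ (u ++ v) w + coeff (map h q) w
      ≈⟨ +-cong (*-congˡ (sym (∑-splits-δ u v w))) (coeff-shift a u h h≡ q w) ⟩
    a * b * ∑[ s ← splits w ] (δ u (proj₁ s) * δ v (proj₂ s)) + ∑[ s ← splits w ] (a * δ u (proj₁ s) * coeff q (proj₂ s))
      ≈⟨ +-congʳ (∑-*ˡ (a * b) (splits w) _) ⟩
    ∑[ s ← splits w ] (a * b * (δ u (proj₁ s) * δ v (proj₂ s))) + ∑[ s ← splits w ] (a * δ u (proj₁ s) * coeff q (proj₂ s))
      ≈⟨ ∑-+ (splits w) _ _ ⟨
    ∑[ s ← splits w ] (a * b * (δ u (proj₁ s) * δ v (proj₂ s)) + a * δ u (proj₁ s) * coeff q (proj₂ s))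
      ≈⟨ ∑-cong′ (splits w) (λ s → sym (trans (*-congˡ (coeff-∷ b v q (proj₂ s))) (regroup _ _ _ _ _))) ⟩
    ∑[ s ← splits w ] (a * δ u (proj₁ s) * coeff ((b , v) ∷ q) (proj₂ s)) ∎
    where
    regroup : ∀ x y z t r → x * y * (z * t + r) ≈ x * z * (y * t) + x * y * r
    regroup x y z t r = trans (distribˡ _ _ _) (+-congʳ (*-interchange x y z t))

  coeff-⊗ : ∀ p q w → coeff (p ⊗ q) w ≈ ∑[ s ← splits w ] (coeff p (proj₁ s) * coeff q (proj₂ s))
  coeff-⊗ []            q w = sym (∑-zero (splits w) _ (λ _ → zeroˡ _))
  coeff-⊗ ((a , u) ∷ p) q w = begin
    coeff (map (λ { (b , v) → (a * b , u ++ v) }) q ++ (p ⊗ q)) w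
      ≈⟨ coeff-++ (map (λ { (b , v) → (a * b , u ++ v) }) q) (p ⊗ q) w ⟩
    coeff (map (λ { (b , v) → (a * b , u ++ v) }) q) w + coeff (p ⊗ q) w
      ≈⟨ +-cong (coeff-shift a u _ (λ _ → Eq.refl) q w) (coeff-⊗ p q w) ⟩
    ∑[ s ← splits w ] (a * δ u (proj₁ s) * coeff q (proj₂ s)) + ∑[ s ← splits w ] (coeff p (proj₁ s) * coeff q (proj₂ s))
      ≈⟨ ∑-+ (splits w) _ _ ⟨
    ∑[ s ← splits w ] (a * δ u (proj₁ s) * coeff q (proj₂ s) + coeff p (proj₁ s) * coeff q (proj₂ s))
      ≈⟨ ∑-cong′ (splits w) (λ s → trans (sym (distribʳ _ _ _)) (*-congʳ (sym (coeff-∷ a u p (proj₁ s))))) ⟩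
    ∑[ s ← splits w ] (coeff ((a , u) ∷ p) (proj₁ s) * coeff q (proj₂ s)) ∎

  splits-++ : ∀ w {s} → s ∈ splits w → proj₁ s ++ proj₂ s ≡ w
  splits-++ w       (here Eq.refl) = Eq.refl
  splits-++ (x ∷ w) (there s∈) with ∈-map⁻ (extendPrefix x) s∈
  ... | _ , s′∈ , Eq.refl = Eq.cong (x ∷_) (splits-++ w s′∈)

  splits-length : ∀ w {s} → s ∈ splits w → length (proj₁ s) ℕ.+ length (proj₂ s) ≡ length w
  splits-length w {s} s∈ = Eq.trans (Eq.sym (ListP.length-++ (proj₁ s))) (Eq.cong length (splits-++ w s∈))

  splits-length₁ : ∀ w {s} → s ∈ splits w → length (proj₁ s) ≤ length w
  splits-length₁ w {s} s∈ = ℕP.m+n≤o⇒m≤o (length (proj₁ s)) (ℕP.≤-reflexive (splits-length w s∈))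

  splits-length₂ : ∀ w {s} → s ∈ splits w → length (proj₂ s) ≤ length w
  splits-length₂ w {s} s∈ = ℕP.m+n≤o⇒n≤o (length (proj₁ s)) (ℕP.≤-reflexive (splits-length w s∈))

  splits⁺-length₂ : ∀ w {s} → s ∈ splits⁺ w → length (proj₂ s) < length w
  splits⁺-length₂ (x ∷ w) s∈ with ∈-map⁻ (extendPrefix x) s∈
  ... | _ , s′∈ , Eq.refl = s≤s (splits-length₂ w s′∈)

  ∑-splits-full : ∀ w (F : Word × Word → Carrier) →
    (∀ {s} → s ∈ splits w → length (proj₁ s) < length w → F s ≈ 0#) → ∑ (splits w) F ≈ F (w , [])
  ∑-splits-full []      F h = +-identityʳ _
  ∑-splits-full (x ∷ w) F h = begin
    F ([] , x ∷ w) + ∑ (map (extendPrefix x) (splits w)) F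
      ≈⟨ +-congˡ (reflexive (∑-map (extendPrefix x) (splits w) F)) ⟩
    F ([] , x ∷ w) + ∑[ s ← splits w ] F (extendPrefix x s)
      ≈⟨ +-cong (h (here Eq.refl) (s≤s z≤n))
                (∑-splits-full w (F ∘ extendPrefix x) (λ s∈ s< → h (there (∈-map⁺ (extendPrefix x) s∈)) (s≤s s<))) ⟩
    0# + F (x ∷ w , [])
      ≈⟨ +-identityˡ _ ⟩
    F (x ∷ w , []) ∎

  Homogeneous : ℕ → Poly → Set c
  Homogeneous j p = All (λ t → length (proj₂ t) ≡ j) p

  homogeneous-coeff : ∀ j p w → Homogeneous j p → length w ≢ j → coeff p w ≈ 0#
  homogeneous-coeff j []            w []           _   = refl
  homogeneous-coeff j ((a , u) ∷ p) w (∣u∣≡j ∷ hp) ∣w∣≢j = begin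
    coeff ((a , u) ∷ p) w        ≈⟨ coeff-∷ a u p w ⟩
    a * δ u w + coeff p w        ≈⟨ +-cong (trans (*-congˡ (δ-≢ u w u≢w)) (zeroʳ a)) (homogeneous-coeff j p w hp ∣w∣≢j) ⟩
    0# + 0#                      ≈⟨ +-identityˡ 0# ⟩
    0#                           ∎
    where
    u≢w : u ≢ w
    u≢w Eq.refl = ∣w∣≢j ∣u∣≡j

  homogeneous-sumP : ∀ {a} {A : Set a} {j} (h : A → Poly) (xs : List A) →
                     (∀ {x} → x ∈ xs → Homogeneous j (h x)) → Homogeneous j (sumP (map h xs))
  homogeneous-sumP h []       hh = []
  homogeneous-sumP h (x ∷ xs) hh = AllP.++⁺ (hh (here Eq.refl)) (homogeneous-sumP h xs (hh ∘ there))

  homogeneous-· : ∀ {j} k p → Homogeneous j p → Homogeneous j (k · p)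
  homogeneous-· k []            []        = []
  homogeneous-· k ((a , u) ∷ p) (e ∷ hp) = e ∷ homogeneous-· k p hp

  homogeneous-shift : ∀ {j} a u (h : Carrier × Word → Carrier × Word) →
    (∀ t → h t ≡ (a * proj₁ t , u ++ proj₂ t)) →
    ∀ q → Homogeneous j q → Homogeneous (length u ℕ.+ j) (map h q)
  homogeneous-shift a u h h≡ []            []       = []
  homogeneous-shift a u h h≡ ((b , v) ∷ q) (e ∷ hq) rewrite h≡ (b , v) =
    Eq.trans (ListP.length-++ u) (Eq.cong (length u ℕ.+_) e) ∷ homogeneous-shift a u h h≡ q hq

  homogeneous-⊗ : ∀ {i j} p q → Homogeneous i p → Homogeneous j q → Homogeneous (i ℕ.+ j) (p ⊗ q)
  homogeneous-⊗ []            q []       hq = []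
  homogeneous-⊗ {i} {j} ((a , u) ∷ p) q (e ∷ hp) hq =
    AllP.++⁺ (Eq.subst (λ k → Homogeneous (k ℕ.+ j) (map shift q)) e
                       (homogeneous-shift a u shift (λ _ → Eq.refl) q hq))
             (homogeneous-⊗ p q hp hq)
    where
    shift : Carrier × Word → Carrier × Word
    shift = λ { (b , v) → (a * b , u ++ v) }

  homogeneous-prodP : ∀ ps → All (Homogeneous 1) ps → Homogeneous (length ps) (prodP ps)
  homogeneous-prodP []       []         = Eq.refl ∷ []
  homogeneous-prodP (p ∷ ps) (hp ∷ hps) = homogeneous-⊗ p (prodP ps) hp (homogeneous-prodP ps hps)

  homogeneous-homPart : ∀ j p → Homogeneous j (homPart j p)
  homogeneous-homPart j p = AllP.all-filter (λ t → length (proj₂ t) ℕ.≟ j) p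

  coeff-homPart : ∀ j p w → length w ≡ j → coeff (homPart j p) w ≈ coeff p w
  coeff-homPart j []            w _ = refl
  coeff-homPart j ((a , u) ∷ p) w ∣w∣≡j with length u ℕ.≟ j
  ... | yes ∣u∣≡j rewrite ListP.filter-accept (λ t → length (proj₂ t) ℕ.≟ j) {x = (a , u)} {xs = p} ∣u∣≡j =
    trans (coeff-∷ a u _ w) (trans (+-congˡ (coeff-homPart j p w ∣w∣≡j)) (sym (coeff-∷ a u p w)))
  ... | no  ∣u∣≢j rewrite ListP.filter-reject (λ t → length (proj₂ t) ℕ.≟ j) {x = (a , u)} {xs = p} ∣u∣≢j = begin
    coeff (homPart j p) w      ≈⟨ coeff-homPart j p w ∣w∣≡j ⟩
    coeff p w                  ≈⟨ +-identityˡ _ ⟨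
    0# + coeff p w             ≈⟨ +-congʳ (trans (*-congˡ (δ-≢ u w u≢w)) (zeroʳ a)) ⟨
    a * δ u w + coeff p w      ≈⟨ coeff-∷ a u p w ⟨
    coeff ((a , u) ∷ p) w      ∎
    where
    u≢w : u ≢ w
    u≢w Eq.refl = ∣u∣≢j ∣w∣≡j

  sign : ℕ → Carrier
  sign n = if even n then 1# else - 1#

  sign-suc : ∀ n → sign (suc n) ≈ - sign n
  sign-suc zero          = refl
  sign-suc (suc zero)    = sym (-‿involutive 1#)
  sign-suc (suc (suc n)) = sign-suc n

  sign-+ : ∀ a b → sign (a ℕ.+ b) ≈ sign a * sign b
  sign-+ zero    b = sym (*-identityˡ _)
  sign-+ (suc a) b = begin
    sign (suc (a ℕ.+ b))     ≈⟨ sign-suc (a ℕ.+ b) ⟩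
    - sign (a ℕ.+ b)         ≈⟨ -‿cong (sign-+ a b) ⟩
    - (sign a * sign b)      ≈⟨ -‿distribˡ-* _ _ ⟩
    - sign a * sign b        ≈⟨ *-congʳ (sign-suc a) ⟨
    sign (suc a) * sign b    ∎

  pairSign : ∀ {m} → Fin m → Fin m → Carrier
  pairSign x y = sign (bit (x ≺ y))

  pairSign-anti : ∀ {m} (x y : Fin m) → x ≢ y → pairSign y x ≈ - pairSign x y
  pairSign-anti x y x≢y with x ≺ y in x≺y | y ≺ x in y≺x
  ... | true  | false = sym (-‿involutive 1#)
  ... | false | true  = refl
  ... | true  | true  = ⊥-elim (ℕP.<-asym (holds (toℕ x) (toℕ y) x≺y) (holds (toℕ y) (toℕ x) y≺x))
    where
    holds : ∀ a b → (a <ᵇ b) ≡ true → a < b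
    holds a b e = ℕP.<ᵇ⇒< a b (Eq.subst T (Eq.sym e) _)
  ... | false | false = ⊥-elim (x≢y (FinP.toℕ-injective
          (ℕP.≤-antisym (ℕP.≮⇒≥ (fails (toℕ y) (toℕ x) y≺x)) (ℕP.≮⇒≥ (fails (toℕ x) (toℕ y) x≺y)))))
    where
    fails : ∀ a b → (a <ᵇ b) ≡ false → ¬ (a < b)
    fails a b e a<b = Eq.subst T e (ℕP.<⇒<ᵇ a<b)

  -- The standard polynomial and its expansion along the first letter

  term : ∀ {m} → (Fin m → Poly) → List (Fin m) → Poly
  term p σ = sign (inversions σ) · prodP (map p σ)

  -- S p xs: the standard polynomial in the arguments p x, x ∈ xs;
  -- `standard P` is by definition S (lookup P) (allFin m).
  S : ∀ {m} → (Fin m → Poly) → List (Fin m) → Poly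
  S p xs = sumP (map (term p) (perms xs))

  homogeneous-S : ∀ {m} (p : Fin m → Poly) → (∀ j → Homogeneous 1 (p j)) →
                  ∀ xs → Homogeneous (length xs) (S p xs)
  homogeneous-S p hp xs = homogeneous-sumP (term p) (perms xs) λ {σ} σ∈ →
    homogeneous-· (sign (inversions σ)) (prodP (map p σ))
      (Eq.subst (λ n → Homogeneous n (prodP (map p σ)))
                (Eq.trans (ListP.length-map p σ) (permsN-length (length xs) xs σ∈))
                (homogeneous-prodP (map p σ) (AllP.map⁺ (All.universal hp σ))))

  pickSign : ∀ {m} → Fin m × List (Fin m) → Carrier
  pickSign (y , ys) = sign (#below ys y)

  coeff-term-∷ : ∀ {m} (p : Fin m → Poly) y τ w →
    coeff (term p (y ∷ τ)) w ≈
    sign (#below τ y) * ∑[ t ← splits w ] (coeff (p y) (proj₁ t) * coeff (term p τ) (proj₂ t))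
  coeff-term-∷ p y τ w = begin
    coeff (sign (#below τ y ℕ.+ inversions τ) · (p y ⊗ prodP (map p τ))) w
      ≈⟨ coeff-· _ (p y ⊗ prodP (map p τ)) w ⟩
    sign (#below τ y ℕ.+ inversions τ) * coeff (p y ⊗ prodP (map p τ)) w
      ≈⟨ *-cong (sign-+ (#below τ y) (inversions τ)) (coeff-⊗ (p y) (prodP (map p τ)) w) ⟩
    sign (#below τ y) * sign (inversions τ) * ∑[ t ← splits w ] (coeff (p y) (proj₁ t) * coeff (prodP (map p τ)) (proj₂ t))
      ≈⟨ trans (*-assoc _ _ _) (*-congˡ (∑-*ˡ _ (splits w) _)) ⟩
    sign (#below τ y) * ∑[ t ← splits w ] (sign (inversions τ) * (coeff (p y) (proj₁ t) * coeff (prodP (map p τ)) (proj₂ t)))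
      ≈⟨ *-congˡ (∑-cong′ (splits w) λ t →
           trans (x∙yz≈y∙xz _ _ _) (*-congˡ (sym (coeff-· (sign (inversions τ)) (prodP (map p τ)) (proj₂ t))))) ⟩
    sign (#below τ y) * ∑[ t ← splits w ] (coeff (p y) (proj₁ t) * coeff (term p τ) (proj₂ t)) ∎

  coeff-S-front : ∀ {m} (p : Fin m → Poly) y ys w →
    ∑[ τ ← perms ys ] coeff (term p (y ∷ τ)) w ≈
    pickSign (y , ys) * ∑[ t ← splits w ] (coeff (p y) (proj₁ t) * coeff (S p ys) (proj₂ t))
  coeff-S-front p y ys w = begin
    ∑[ τ ← perms ys ] coeff (term p (y ∷ τ)) w
      ≈⟨ ∑-cong (perms ys) (λ {τ} τ∈ → trans (coeff-term-∷ p y τ w)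
           (*-congʳ (reflexive (Eq.cong sign (perms-#below (length ys) ys τ∈ Eq.refl y))))) ⟩
    ∑[ τ ← perms ys ] (pickSign (y , ys) * ∑[ t ← splits w ] (coeff (p y) (proj₁ t) * coeff (term p τ) (proj₂ t)))
      ≈⟨ ∑-*ˡ _ (perms ys) _ ⟨
    pickSign (y , ys) * ∑[ τ ← perms ys ] ∑[ t ← splits w ] (coeff (p y) (proj₁ t) * coeff (term p τ) (proj₂ t))
      ≈⟨ *-congˡ (∑-swap (perms ys) (splits w) _) ⟩
    pickSign (y , ys) * ∑[ t ← splits w ] ∑[ τ ← perms ys ] (coeff (p y) (proj₁ t) * coeff (term p τ) (proj₂ t))
      ≈⟨ *-congˡ (∑-cong′ (splits w) λ t →
           trans (sym (∑-*ˡ _ (perms ys) _)) (*-congˡ (sym (coeff-sumP (term p) (perms ys) (proj₂ t))))) ⟩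
    pickSign (y , ys) * ∑[ t ← splits w ] (coeff (p y) (proj₁ t) * coeff (S p ys) (proj₂ t)) ∎

  coeff-S-expand : ∀ {m} (p : Fin m → Poly) k (xs : List (Fin m)) → length xs ≡ suc k → ∀ w →
    coeff (S p xs) w ≈
    ∑[ s ← picks xs ] (pickSign s * ∑[ t ← splits w ] (coeff (p (proj₁ s)) (proj₁ t) * coeff (S p (proj₂ s)) (proj₂ t)))
  coeff-S-expand p k xs ∣xs∣≡ w = begin
    coeff (S p xs) w
      ≈⟨ coeff-sumP (term p) (perms xs) w ⟩
    ∑[ σ ← permsN (length xs) xs ] coeff (term p σ) w
      ≡⟨ Eq.cong (λ n → ∑[ σ ← permsN n xs ] coeff (term p σ) w) ∣xs∣≡ ⟩
    ∑[ σ ← concatMap (λ { (y , ys) → map (y ∷_) (permsN k ys) }) (picks xs) ] coeff (term p σ) w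
      ≈⟨ ∑-concatMap _ (picks xs) _ ⟩
    ∑[ s ← picks xs ] ∑[ σ ← map (proj₁ s ∷_) (permsN k (proj₂ s)) ] coeff (term p σ) w
      ≈⟨ ∑-cong (picks xs) (λ {s} s∈ → trans (reflexive (∑-map (proj₁ s ∷_) (permsN k (proj₂ s)) _))
           (trans (reflexive (Eq.cong (λ n → ∑[ τ ← permsN n (proj₂ s) ] coeff (term p (proj₁ s ∷ τ)) w) (k≡ s∈)))
                  (coeff-S-front p (proj₁ s) (proj₂ s) w))) ⟩
    ∑[ s ← picks xs ] (pickSign s * ∑[ t ← splits w ] (coeff (p (proj₁ s)) (proj₁ t) * coeff (S p (proj₂ s)) (proj₂ t))) ∎
    where
    k≡ : ∀ {s} → s ∈ picks xs → k ≡ length (proj₂ s)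
    k≡ s∈ = ℕP.suc-injective (Eq.trans (Eq.sym ∣xs∣≡) (picks-length xs s∈))

  -- Signed sums over ordered pairs of distinct entries are antisymmetric

  ∑-picks-∷ : ∀ {m} (x : Fin m) ys (H : Fin m × List (Fin m) → Carrier) →
              ∑ (picks (x ∷ ys)) H ≈ H (x , ys) + ∑[ t ← picks ys ] H (proj₁ t , x ∷ proj₂ t)
  ∑-picks-∷ x ys H = +-congˡ (reflexive (∑-map _ (picks ys) H))

  pickSign-∷ : ∀ {m} (x y : Fin m) ys → pickSign (y , x ∷ ys) ≈ pairSign x y * pickSign (y , ys)
  pickSign-∷ x y ys = trans (reflexive (Eq.cong sign (#below-∷ x ys y))) (sign-+ (bit (x ≺ y)) (#below ys y))

  pickSign-swap : ∀ {m} (x : Fin m) xs → All (x ≢_) xs → ∀ {t} → t ∈ picks xs → ∀ G →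
    pairSign x (proj₁ t) * pickSign t * (pickSign (x , proj₂ t) * G) ≈ - (pickSign (x , xs) * (pickSign t * G))
  pickSign-swap x xs x∉ {t} t∈ G = begin
    pairSign x (proj₁ t) * pickSign t * (pickSign (x , proj₂ t) * G)
      ≈⟨ *-interchange _ _ _ _ ⟩
    pairSign x (proj₁ t) * pickSign (x , proj₂ t) * (pickSign t * G)
      ≈⟨ *-congʳ (*-congʳ (pairSign-anti (proj₁ t) x (λ e → All.lookup x∉ (picks-chosen∈ xs t∈) (Eq.sym e)))) ⟩
    - pairSign (proj₁ t) x * pickSign (x , proj₂ t) * (pickSign t * G)
      ≈⟨ trans (*-congʳ (sym (-‿distribˡ-* _ _))) (sym (-‿distribˡ-* _ _)) ⟩
    - (pairSign (proj₁ t) x * pickSign (x , proj₂ t) * (pickSign t * G))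
      ≈⟨ -‿cong (*-congʳ (trans (sym (sign-+ (bit (proj₁ t ≺ x)) _)) (reflexive (Eq.cong sign (Eq.sym (picks-#below xs t∈ x)))))) ⟩
    - (pickSign (x , xs) * (pickSign t * G)) ∎

  module _ {m : ℕ} where

    -- A quantity attached to an ordered pair (y , z) and the list zs of the other entries.
    PairFn : Set c
    PairFn = Fin m → Fin m → List (Fin m) → Carrier

    -- Σ over a pick (y , ys) of xs and a pick (z , zs) of ys, with the signs
    -- of both picks: a signed sum over the ordered pairs of entries of xs.
    pairSum : PairFn → List (Fin m) → Carrier
    pairSum F xs =
      ∑[ s ← picks xs ] (pickSign s * ∑[ t ← picks (proj₂ s) ] (pickSign t * F (proj₁ s) (proj₁ t) (proj₂ t)))

    flipPair : PairFn → PairFn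
    flipPair F y z zs = F z y zs

    pairSum-cong : ∀ (F G : PairFn) xs → (∀ y z zs → F y z zs ≈ G y z zs) → pairSum F xs ≈ pairSum G xs
    pairSum-cong F G xs F≈G =
      ∑-cong′ (picks xs) λ s → *-congˡ (∑-cong′ (picks (proj₂ s)) λ t → *-congˡ (F≈G _ _ _))

    -- The three kinds of pairs in x ∷ xs: x is chosen first, x is chosen
    -- second, or x is among the remaining entries.
    xFirst : Fin m → List (Fin m) → PairFn → Carrier
    xFirst x xs F = pickSign (x , xs) * ∑[ t ← picks xs ] (pickSign t * F x (proj₁ t) (proj₂ t))

    xSecond : Fin m → List (Fin m) → PairFn → Carrier
    xSecond x xs F =
      ∑[ s ← picks xs ] (pairSign x (proj₁ s) * pickSign s * (pickSign (x , proj₂ s) * F (proj₁ s) x (proj₂ s)))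

    xRest : Fin m → PairFn → PairFn
    xRest x F y z zs = pairSign x y * pairSign x z * F y z (x ∷ zs)

    pairSum-∷ : ∀ x xs F → pairSum F (x ∷ xs) ≈ xFirst x xs F + (xSecond x xs F + pairSum (xRest x F) xs)
    pairSum-∷ x xs F =
      trans (∑-picks-∷ x xs (λ s → pickSign s * ∑[ t ← picks (proj₂ s) ] (pickSign t * F (proj₁ s) (proj₁ t) (proj₂ t))))
            (+-cong refl
                    (trans (∑-cong′ (picks xs) λ s → splitTerm (proj₁ s) (proj₂ s)) (∑-+ (picks xs) _ _)))
      where
      splitTerm : ∀ y ys →
        pickSign (y , x ∷ ys) * ∑[ t ← picks (x ∷ ys) ] (pickSign t * F y (proj₁ t) (proj₂ t)) ≈
        pairSign x y * pickSign (y , ys) * (pickSign (x , ys) * F y x ys)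
          + pickSign (y , ys) * ∑[ t ← picks ys ] (pickSign t * xRest x F y (proj₁ t) (proj₂ t))
      splitTerm y ys = begin
        pickSign (y , x ∷ ys) * ∑[ t ← picks (x ∷ ys) ] (pickSign t * F y (proj₁ t) (proj₂ t))
          ≈⟨ *-cong (pickSign-∷ x y ys) (∑-picks-∷ x ys _) ⟩
        pairSign x y * pickSign (y , ys) *
          (pickSign (x , ys) * F y x ys + ∑[ t ← picks ys ] (pickSign (proj₁ t , x ∷ proj₂ t) * F y (proj₁ t) (x ∷ proj₂ t)))
          ≈⟨ distribˡ _ _ _ ⟩
        pairSign x y * pickSign (y , ys) * (pickSign (x , ys) * F y x ys)
          + pairSign x y * pickSign (y , ys) * ∑[ t ← picks ys ] (pickSign (proj₁ t , x ∷ proj₂ t) * F y (proj₁ t) (x ∷ proj₂ t))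
          ≈⟨ +-congˡ (trans (*-congʳ (*-comm _ _)) (trans (*-assoc _ _ _) (*-congˡ (trans (∑-*ˡ _ (picks ys) _)
               (∑-cong′ (picks ys) λ t → moveSigns (proj₁ t) (proj₂ t)))))) ⟩
        pairSign x y * pickSign (y , ys) * (pickSign (x , ys) * F y x ys)
          + pickSign (y , ys) * ∑[ t ← picks ys ] (pickSign t * xRest x F y (proj₁ t) (proj₂ t)) ∎
        where
        moveSigns : ∀ z zs → pairSign x y * (pickSign (z , x ∷ zs) * F y z (x ∷ zs)) ≈
                             pickSign (z , zs) * xRest x F y z zs
        moveSigns z zs = begin
          pairSign x y * (pickSign (z , x ∷ zs) * F y z (x ∷ zs))
            ≈⟨ *-congˡ (*-congʳ (pickSign-∷ x z zs)) ⟩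
          pairSign x y * (pairSign x z * pickSign (z , zs) * F y z (x ∷ zs))
            ≈⟨ *-congˡ (trans (*-congʳ (*-comm _ _)) (*-assoc _ _ _)) ⟩
          pairSign x y * (pickSign (z , zs) * (pairSign x z * F y z (x ∷ zs)))
            ≈⟨ x∙yz≈y∙xz _ _ _ ⟩
          pickSign (z , zs) * (pairSign x y * (pairSign x z * F y z (x ∷ zs)))
            ≈⟨ *-congˡ (*-assoc _ _ _) ⟨
          pickSign (z , zs) * xRest x F y z zs ∎

    xSecond≈-xFirst : ∀ x xs → All (x ≢_) xs → ∀ F → xSecond x xs F ≈ - xFirst x xs (flipPair F)
    xSecond≈-xFirst x xs x∉ F = begin
      xSecond x xs F
        ≈⟨ ∑-cong (picks xs) (λ t∈ → pickSign-swap x xs x∉ t∈ _) ⟩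
      ∑[ t ← picks xs ] (- (pickSign (x , xs) * (pickSign t * F (proj₁ t) x (proj₂ t))))
        ≈⟨ ∑-neg (picks xs) _ ⟩
      - ∑[ t ← picks xs ] (pickSign (x , xs) * (pickSign t * F (proj₁ t) x (proj₂ t)))
        ≈⟨ -‿cong (∑-*ˡ _ (picks xs) _) ⟨
      - xFirst x xs (flipPair F) ∎

    pairSum-antisym : ∀ xs → Unique xs → ∀ F → pairSum F xs ≈ - pairSum (flipPair F) xs
    pairSum-antisym []       _         F = sym -0#≈0#
    pairSum-antisym (x ∷ xs) (x∉ ∷ u) F = begin
      pairSum F (x ∷ xs)
        ≈⟨ pairSum-∷ x xs F ⟩
      xFirst x xs F + (xSecond x xs F + pairSum (xRest x F) xs)
        ≈⟨ +-cong (trans (sym (-‿involutive _)) (-‿cong (sym (xSecond≈-xFirst x xs x∉ (flipPair F)))))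
                  (+-cong (xSecond≈-xFirst x xs x∉ F)
                          (trans (pairSum-antisym xs u (xRest x F))
                                 (-‿cong (pairSum-cong _ _ xs λ y z zs → *-congʳ (*-comm _ _))))) ⟩
      - xSecond x xs (flipPair F) + (- xFirst x xs (flipPair F) + - pairSum (xRest x (flipPair F)) xs)
        ≈⟨ trans (+-congˡ (-‿+-comm _ _)) (-‿+-comm _ _) ⟩
      - (xSecond x xs (flipPair F) + (xFirst x xs (flipPair F) + pairSum (xRest x (flipPair F)) xs))
        ≈⟨ -‿cong (trans (sym (+-assoc _ _ _)) (trans (+-congʳ (+-comm _ _)) (+-assoc _ _ _))) ⟩
      - (xFirst x xs (flipPair F) + (xSecond x xs (flipPair F) + pairSum (xRest x (flipPair F)) xs))
        ≈⟨ -‿cong (pairSum-∷ x xs (flipPair F)) ⟨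
      - pairSum (flipPair F) (x ∷ xs) ∎

  -- The low-degree lemma

  oneLetterPrefix : ∀ w {t} → t ∈ splits⁺ w → length w ≤ suc (length (proj₂ t)) → length (proj₁ t) ≡ 1
  oneLetterPrefix (x ∷ w) t∈ ∣w∣≤ with ∈-map⁻ (extendPrefix x) t∈
  ... | (u , v) , uv∈ , Eq.refl = Eq.cong suc (ℕP.n≤0⇒n≡0 (ℕP.+-cancelʳ-≤ (length v) (length u) 0
          (ℕP.≤-trans (ℕP.≤-reflexive (splits-length w uv∈)) (ℕP.≤-pred ∣w∣≤))))

  -- Fix families p and q of polynomials where q j is the linear part of p j:
  -- homogeneous of degree 1 and agreeing with p j on one-letter words.
  module LowDegree (half : ∀ x → x ≈ - x → x ≈ 0#) {m : ℕ} (p q : Fin m → Poly)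
                   (q-linear : ∀ j → Homogeneous 1 (q j))
                   (q≈p : ∀ j u → length u ≡ 1 → coeff (q j) u ≈ coeff (p j) u) where

    Sp Sq : List (Fin m) → Word → Carrier
    Sp xs w = coeff (S p xs) w
    Sq xs w = coeff (S q xs) w

    const : Fin m → Carrier
    const y = coeff (p y) []

    -- The part of the first-letter expansion in which the first factor
    -- contributes its constant term ...
    constFirst : List (Fin m) → Word → Carrier
    constFirst xs w = ∑[ s ← picks xs ] (pickSign s * (const (proj₁ s) * Sp (proj₂ s) w))

    -- ... and the part in which it contributes a nonempty prefix, with the
    -- coefficients of the rest given by an arbitrary function Rr.
    properFirst : (List (Fin m) → Word → Carrier) → List (Fin m) → Word → Carrier
    properFirst Rr xs w =
      ∑[ s ← picks xs ] (pickSign s * ∑[ t ← splits⁺ w ] (coeff (p (proj₁ s)) (proj₁ t) * Rr (proj₂ s) (proj₂ t)))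

    Sp-split : ∀ k xs → length xs ≡ suc k → ∀ w → Sp xs w ≈ constFirst xs w + properFirst Sp xs w
    Sp-split k xs ∣xs∣≡ w =
      trans (coeff-S-expand p k xs ∣xs∣≡ w) (trans (∑-cong′ (picks xs) λ s → distribˡ _ _ _) (∑-+ (picks xs) _ _))

    -- Against the homogeneous S(q; ys), only one-letter prefixes contribute,
    -- and on those p agrees with q.
    linearPrefix : ∀ y ys w → length w ≤ suc (length ys) →
      ∑[ t ← splits⁺ w ] (coeff (p y) (proj₁ t) * Sq ys (proj₂ t)) ≈
      ∑[ t ← splits w ] (coeff (q y) (proj₁ t) * Sq ys (proj₂ t))
    linearPrefix y ys w ∣w∣≤ = sym (begin
      coeff (q y) [] * Sq ys w + ∑[ t ← splits⁺ w ] (coeff (q y) (proj₁ t) * Sq ys (proj₂ t))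
        ≈⟨ +-congʳ (trans (*-congʳ (homogeneous-coeff 1 (q y) [] (q-linear y) (λ ()))) (zeroˡ _)) ⟩
      0# + ∑[ t ← splits⁺ w ] (coeff (q y) (proj₁ t) * Sq ys (proj₂ t))
        ≈⟨ +-identityˡ _ ⟩
      ∑[ t ← splits⁺ w ] (coeff (q y) (proj₁ t) * Sq ys (proj₂ t))
        ≈⟨ ∑-cong (splits⁺ w) sameTerm ⟩
      ∑[ t ← splits⁺ w ] (coeff (p y) (proj₁ t) * Sq ys (proj₂ t)) ∎)
      where
      sameTerm : ∀ {t} → t ∈ splits⁺ w → coeff (q y) (proj₁ t) * Sq ys (proj₂ t) ≈ coeff (p y) (proj₁ t) * Sq ys (proj₂ t)
      sameTerm {t} t∈ with length (proj₁ t) ℕ.≟ 1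
      ... | yes ∣t₁∣≡1 = *-congʳ (q≈p y (proj₁ t) ∣t₁∣≡1)
      ... | no  ∣t₁∣≢1 = trans (*-congˡ Sq≈0) (trans (zeroʳ _) (sym (trans (*-congˡ Sq≈0) (zeroʳ _))))
        where
        Sq≈0 : Sq ys (proj₂ t) ≈ 0#
        Sq≈0 = homogeneous-coeff (length ys) (S q ys) (proj₂ t) (homogeneous-S q q-linear ys)
                λ e → ∣t₁∣≢1 (oneLetterPrefix w t∈ (Eq.subst (λ n → length w ≤ suc n) (Eq.sym e) ∣w∣≤))

    properFirst-reduce : ∀ k xs w → length xs ≡ suc k → length w ≤ suc k → (Rr : List (Fin m) → Word → Carrier) →
      (∀ {s} → s ∈ picks xs → ∀ {t} → t ∈ splits⁺ w →
         Sp (proj₂ s) (proj₂ t) ≈ Sq (proj₂ s) (proj₂ t) + Rr (proj₂ s) (proj₂ t)) →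
      properFirst Sp xs w ≈ Sq xs w + properFirst Rr xs w
    properFirst-reduce k xs w ∣xs∣≡ ∣w∣≤ Rr Sp≈Sq+Rr = begin
      properFirst Sp xs w
        ≈⟨ ∑-cong (picks xs) (λ s∈ → *-congˡ (trans
             (∑-cong (splits⁺ w) λ t∈ → trans (*-congˡ (Sp≈Sq+Rr s∈ t∈)) (distribˡ _ _ _))
             (∑-+ (splits⁺ w) _ _))) ⟩
      ∑[ s ← picks xs ] (pickSign s * (∑[ t ← splits⁺ w ] (coeff (p (proj₁ s)) (proj₁ t) * Sq (proj₂ s) (proj₂ t))
                                      + ∑[ t ← splits⁺ w ] (coeff (p (proj₁ s)) (proj₁ t) * Rr (proj₂ s) (proj₂ t))))
        ≈⟨ trans (∑-cong′ (picks xs) λ s → distribˡ _ _ _) (∑-+ (picks xs) _ _) ⟩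
      ∑[ s ← picks xs ] (pickSign s * ∑[ t ← splits⁺ w ] (coeff (p (proj₁ s)) (proj₁ t) * Sq (proj₂ s) (proj₂ t)))
        + properFirst Rr xs w
        ≈⟨ +-congʳ (∑-cong (picks xs) λ {s} s∈ → *-congˡ (linearPrefix (proj₁ s) (proj₂ s) w
              (Eq.subst (λ n → length w ≤ n) (Eq.trans (Eq.sym ∣xs∣≡) (picks-length xs s∈)) ∣w∣≤))) ⟩
      ∑[ s ← picks xs ] (pickSign s * ∑[ t ← splits w ] (coeff (q (proj₁ s)) (proj₁ t) * Sq (proj₂ s) (proj₂ t)))
        + properFirst Rr xs w
        ≈⟨ +-congʳ (coeff-S-expand q k xs ∣xs∣≡ w) ⟨
      Sq xs w + properFirst Rr xs w ∎

    properFirst-zero : ∀ xs w → properFirst (λ _ _ → 0#) xs w ≈ 0#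
    properFirst-zero xs w =
      ∑-zero (picks xs) _ λ _ → trans (*-congˡ (∑-zero (splits⁺ w) _ λ _ → zeroʳ _)) (zeroʳ _)

    bothConst : Word → PairFn
    bothConst w y z zs = const y * (const z * Sp zs w)

    constThenProper : Word → PairFn
    constThenProper w y z zs = const y * ∑[ t ← splits⁺ w ] (coeff (p z) (proj₁ t) * Sp zs (proj₂ t))

    constFirst-expand : ∀ k xs w → length xs ≡ suc (suc k) →
      constFirst xs w ≈ pairSum (bothConst w) xs + pairSum (constThenProper w) xs
    constFirst-expand k xs w ∣xs∣≡ = begin
      constFirst xs w
        ≈⟨ ∑-cong (picks xs) (λ {s} s∈ → *-congˡ (*-congˡ (Sp-split k (proj₂ s) (∣rest∣≡ s∈) w))) ⟩
      ∑[ s ← picks xs ] (pickSign s * (const (proj₁ s) * (constFirst (proj₂ s) w + properFirst Sp (proj₂ s) w)))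
        ≈⟨ ∑-cong′ (picks xs) (λ s → trans (*-congˡ (distribˡ _ _ _)) (distribˡ _ _ _)) ⟩
      ∑[ s ← picks xs ] (pickSign s * (const (proj₁ s) * constFirst (proj₂ s) w)
                         + pickSign s * (const (proj₁ s) * properFirst Sp (proj₂ s) w))
        ≈⟨ ∑-+ (picks xs) _ _ ⟩
      ∑[ s ← picks xs ] (pickSign s * (const (proj₁ s) * constFirst (proj₂ s) w))
        + ∑[ s ← picks xs ] (pickSign s * (const (proj₁ s) * properFirst Sp (proj₂ s) w))
        ≈⟨ +-cong (∑-cong′ (picks xs) λ s → *-congˡ (pull (const (proj₁ s)) (proj₂ s) _))
                  (∑-cong′ (picks xs) λ s → *-congˡ (pull (const (proj₁ s)) (proj₂ s) _)) ⟩
      pairSum (bothConst w) xs + pairSum (constThenProper w) xs ∎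
      where
      ∣rest∣≡ : ∀ {s} → s ∈ picks xs → length (proj₂ s) ≡ suc k
      ∣rest∣≡ s∈ = ℕP.suc-injective (Eq.trans (Eq.sym (picks-length xs s∈)) ∣xs∣≡)
      pull : ∀ a ys (X : Fin m × List (Fin m) → Carrier) →
             a * ∑[ t ← picks ys ] (pickSign t * X t) ≈ ∑[ t ← picks ys ] (pickSign t * (a * X t))
      pull a ys X = trans (∑-*ˡ a (picks ys) _) (∑-cong′ (picks ys) λ t → x∙yz≈y∙xz a (pickSign t) (X t))

    -- bothConst is symmetric, so its antisymmetric pair sum vanishes.
    bothConst-vanishes : ∀ xs → Unique xs → ∀ w → pairSum (bothConst w) xs ≈ 0#
    bothConst-vanishes xs u w = half _ (trans (pairSum-antisym xs u (bothConst w))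
      (-‿cong (pairSum-cong _ _ xs λ y z zs → x∙yz≈y∙xz (const z) (const y) (Sp zs w))))

    properFirst-constFirst : ∀ xs w → properFirst constFirst xs w ≈ pairSum (flipPair (constThenProper w)) xs
    properFirst-constFirst xs w = ∑-cong′ (picks xs) λ s → *-congˡ (exchange (proj₁ s) (proj₂ s))
      where
      exchange : ∀ y ys →
        ∑[ t′ ← splits⁺ w ] (coeff (p y) (proj₁ t′) * constFirst ys (proj₂ t′)) ≈
        ∑[ t ← picks ys ] (pickSign t * constThenProper w (proj₁ t) y (proj₂ t))
      exchange y ys = begin
        ∑[ t′ ← splits⁺ w ] (coeff (p y) (proj₁ t′) * constFirst ys (proj₂ t′))
          ≈⟨ ∑-cong′ (splits⁺ w) (λ t′ → trans (∑-*ˡ _ (picks ys) _)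
               (∑-cong′ (picks ys) λ t → trans (x∙yz≈y∙xz _ _ _) (*-congˡ (x∙yz≈y∙xz _ _ _)))) ⟩
        ∑[ t′ ← splits⁺ w ] ∑[ t ← picks ys ] (pickSign t * (const (proj₁ t) * (coeff (p y) (proj₁ t′) * Sp (proj₂ t) (proj₂ t′))))
          ≈⟨ ∑-swap (splits⁺ w) (picks ys) _ ⟩
        ∑[ t ← picks ys ] ∑[ t′ ← splits⁺ w ] (pickSign t * (const (proj₁ t) * (coeff (p y) (proj₁ t′) * Sp (proj₂ t) (proj₂ t′))))
          ≈⟨ ∑-cong′ (picks ys) (λ t → trans (sym (∑-*ˡ _ (splits⁺ w) _)) (*-congˡ (sym (∑-*ˡ _ (splits⁺ w) _)))) ⟩
        ∑[ t ← picks ys ] (pickSign t * constThenProper w (proj₁ t) y (proj₂ t)) ∎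

    mutual
      lowDegree-even : ∀ j xs w → length xs ≡ j ℕ.+ j → Unique xs → length w ≤ j ℕ.+ j → Sp xs w ≈ Sq xs w
      lowDegree-even zero    []  w _      _ _      = refl
      lowDegree-even (suc j) xs  w ∣xs∣≡ u ∣w∣≤ = begin
        Sp xs w
          ≈⟨ Sp-split (j ℕ.+ suc j) xs ∣xs∣≡ w ⟩
        constFirst xs w + properFirst Sp xs w
          ≈⟨ +-cong (constFirst-expand (j ℕ.+ j) xs w (Eq.trans ∣xs∣≡ (Eq.cong suc (ℕP.+-suc j j))))
                    (properFirst-reduce (j ℕ.+ suc j) xs w ∣xs∣≡ ∣w∣≤ constFirst oddRest) ⟩
        (pairSum (bothConst w) xs + pairSum F xs) + (Sq xs w + properFirst constFirst xs w)
          ≈⟨ +-cong (trans (+-congʳ (bothConst-vanishes xs u w)) (+-identityˡ _))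
                    (+-congˡ (properFirst-constFirst xs w)) ⟩
        pairSum F xs + (Sq xs w + pairSum (flipPair F) xs)
          ≈⟨ trans (+-congˡ (+-comm _ _)) (trans (sym (+-assoc _ _ _)) (+-comm _ _)) ⟩
        Sq xs w + (pairSum F xs + pairSum (flipPair F) xs)
          ≈⟨ +-congˡ (trans (+-congʳ (pairSum-antisym xs u F)) (-‿inverseˡ _)) ⟩
        Sq xs w + 0#
          ≈⟨ +-identityʳ _ ⟩
        Sq xs w ∎
        where
        F : PairFn
        F = constThenProper w
        oddRest : ∀ {s} → s ∈ picks xs → ∀ {t} → t ∈ splits⁺ w →
              Sp (proj₂ s) (proj₂ t) ≈ Sq (proj₂ s) (proj₂ t) + constFirst (proj₂ s) (proj₂ t)
        oddRest {s} s∈ {t} t∈ = lowDegree-odd j (proj₂ s) (proj₂ t)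
          (Eq.trans (ℕP.suc-injective (Eq.trans (Eq.sym (picks-length xs s∈)) ∣xs∣≡)) (ℕP.+-suc j j))
          (picks-unique xs s∈ u)
          (Eq.subst (length (proj₂ t) ≤_) (ℕP.+-suc j j) (ℕP.≤-pred (ℕP.≤-trans (splits⁺-length₂ w t∈) ∣w∣≤)))

      lowDegree-odd : ∀ j xs w → length xs ≡ suc (j ℕ.+ j) → Unique xs → length w ≤ suc (j ℕ.+ j) →
                      Sp xs w ≈ Sq xs w + constFirst xs w
      lowDegree-odd j xs w ∣xs∣≡ u ∣w∣≤ = begin
        Sp xs w
          ≈⟨ Sp-split (j ℕ.+ j) xs ∣xs∣≡ w ⟩
        constFirst xs w + properFirst Sp xs w
          ≈⟨ +-congˡ (properFirst-reduce (j ℕ.+ j) xs w ∣xs∣≡ ∣w∣≤ (λ _ _ → 0#) evenRest) ⟩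
        constFirst xs w + (Sq xs w + properFirst (λ _ _ → 0#) xs w)
          ≈⟨ +-congˡ (trans (+-congˡ (properFirst-zero xs w)) (+-identityʳ _)) ⟩
        constFirst xs w + Sq xs w
          ≈⟨ +-comm _ _ ⟩
        Sq xs w + constFirst xs w ∎
        where
        evenRest : ∀ {s} → s ∈ picks xs → ∀ {t} → t ∈ splits⁺ w → Sp (proj₂ s) (proj₂ t) ≈ Sq (proj₂ s) (proj₂ t) + 0#
        evenRest {s} s∈ {t} t∈ = trans (lowDegree-even j (proj₂ s) (proj₂ t)
          (ℕP.suc-injective (Eq.trans (Eq.sym (picks-length xs s∈)) ∣xs∣≡))
          (picks-unique xs s∈ u)
          (ℕP.≤-pred (ℕP.≤-trans (splits⁺-length₂ w t∈) ∣w∣≤))) (sym (+-identityʳ _))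

  two-invertible⇒half : (∃ λ y → y * natToR R 2 ≈ 1#) → ∀ x → x ≈ - x → x ≈ 0#
  two-invertible⇒half (y , y*2≈1) x x≈-x = begin
    x                      ≈⟨ *-identityˡ x ⟨
    1# * x                 ≈⟨ *-congʳ y*2≈1 ⟨
    y * natToR R 2 * x     ≈⟨ *-assoc _ _ _ ⟩
    y * (natToR R 2 * x)   ≈⟨ *-congˡ twice≈0 ⟩
    y * 0#                 ≈⟨ zeroʳ y ⟩
    0#                     ∎
    where
    twice≈0 : natToR R 2 * x ≈ 0#
    twice≈0 = begin
      (1# + (1# + 0#)) * x     ≈⟨ trans (*-congʳ (+-congˡ (+-identityʳ 1#))) (distribʳ x 1# 1#) ⟩
      1# * x + 1# * x          ≈⟨ +-cong (*-identityˡ x) (*-identityˡ x) ⟩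
      x + x                    ≈⟨ +-congʳ x≈-x ⟩
      - x + x                  ≈⟨ -‿inverseˡ x ⟩
      0#                       ∎

  linearPart-entry : ∀ {k} (P : Vec Poly k) j → lookup (Vec.map (homPart 1) P) j ≡ homPart 1 (lookup P j)
  linearPart-entry P j = VecP.lookup-map j (homPart 1) P

  homogeneous-standard : ∀ {k} (P : Vec Poly k) → (∀ j → Homogeneous 1 (lookup P j)) → Homogeneous k (standard P)
  homogeneous-standard {k} P linear =
    Eq.subst (λ n → Homogeneous n (standard P)) (ListP.length-tabulate (λ i → i)) (homogeneous-S (lookup P) linear (allFin k))

  homogeneous-standard-linear : ∀ {k} (P : Vec Poly k) → Homogeneous k (standard (Vec.map (homPart 1) P))
  homogeneous-standard-linear P = homogeneous-standard (Vec.map (homPart 1) P) λ j →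
    Eq.subst (Homogeneous 1) (Eq.sym (linearPart-entry P j)) (homogeneous-homPart 1 (lookup P j))

  standard-lowDegree : (∀ x → x ≈ - x → x ≈ 0#) → ∀ d (P : Vec Poly (2 ℕ.* d)) v → length v ≤ 2 ℕ.* d →
                       coeff (standard P) v ≈ coeff (standard (Vec.map (homPart 1) P)) v
  standard-lowDegree half d P v ∣v∣≤ =
    lowDegree-even d (allFin (2 ℕ.* d)) v (Eq.trans (ListP.length-tabulate (λ i → i)) 2d≡d+d) (allFin⁺ (2 ℕ.* d))
                   (Eq.subst (length v ≤_) 2d≡d+d ∣v∣≤)
    where
    open LowDegree half (lookup P) (lookup (Vec.map (homPart 1) P))
      (λ j → Eq.subst (Homogeneous 1) (Eq.sym (linearPart-entry P j)) (homogeneous-homPart 1 (lookup P j)))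
      (λ j u ∣u∣≡1 → Eq.subst (λ g → coeff g u ≈ coeff (lookup P j) u) (Eq.sym (linearPart-entry P j))
                               (coeff-homPart 1 (lookup P j) u ∣u∣≡1))
    2d≡d+d : 2 ℕ.* d ≡ d ℕ.+ d
    2d≡d+d = Eq.cong (d ℕ.+_) (ℕP.+-identityʳ d)

  sPoly-vanishes : ∀ d n f → IsSPoly d n f → ∀ w → length w ≢ 2 ℕ.* d → coeff f w ≈ 0#
  sPoly-vanishes d n f (chosen , f≃) w ∣w∣≢ =
    trans (f≃ w) (homogeneous-coeff (2 ℕ.* d) _ w (homogeneous-sumP _ (choose (2 ℕ.* d) (allFin n)) λ {js} _ → summand js) ∣w∣≢)
    where
    summand : ∀ (js : Vec (Fin n) (2 ℕ.* d)) →
      Homogeneous (2 ℕ.* d) (if chosen js then standard (Vec.map (λ j → var (toℕ j)) js) else zeroP)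
    summand js with chosen js
    ... | true  = homogeneous-standard (Vec.map (λ j → var (toℕ j)) js)
                    λ j → Eq.subst (Homogeneous 1) (Eq.sym (VecP.lookup-map j (λ j → var (toℕ j)) js)) (Eq.refl ∷ [])
    ... | false = []

  coeff-⊗-local : ∀ a g g′ b w → (∀ v → length v ≤ length w → coeff g v ≈ coeff g′ v) →
                  coeff (a ⊗ g ⊗ b) w ≈ coeff (a ⊗ g′ ⊗ b) w
  coeff-⊗-local a g g′ b w g≈g′ = begin
    coeff (a ⊗ g ⊗ b) w
      ≈⟨ coeff-⊗ (a ⊗ g) b w ⟩
    ∑[ s ← splits w ] (coeff (a ⊗ g) (proj₁ s) * coeff b (proj₂ s))
      ≈⟨ ∑-cong (splits w) (λ {s} s∈ → *-congʳ (trans (coeff-⊗ a g (proj₁ s)) (trans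
           (∑-cong (splits (proj₁ s)) λ t∈ → *-congˡ (g≈g′ _ (ℕP.≤-trans (splits-length₂ _ t∈) (splits-length₁ w s∈))))
           (sym (coeff-⊗ a g′ (proj₁ s)))))) ⟩
    ∑[ s ← splits w ] (coeff (a ⊗ g′) (proj₁ s) * coeff b (proj₂ s))
      ≈⟨ coeff-⊗ (a ⊗ g′) b w ⟨
    coeff (a ⊗ g′ ⊗ b) w ∎

  coeff-⊗-homogeneous : ∀ a g b w → Homogeneous (length w) g →
                        coeff (a ⊗ g ⊗ b) w ≈ coeff a [] * coeff g w * coeff b []
  coeff-⊗-homogeneous a g b w hom = begin
    coeff (a ⊗ g ⊗ b) w
      ≈⟨ coeff-⊗ (a ⊗ g) b w ⟩
    ∑[ s ← splits w ] (coeff (a ⊗ g) (proj₁ s) * coeff b (proj₂ s))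
      ≈⟨ ∑-splits-full w _ (λ {s} _ short → trans (*-congʳ (ag-short (proj₁ s) short)) (zeroˡ _)) ⟩
    coeff (a ⊗ g) w * coeff b []
      ≈⟨ *-congʳ (trans (coeff-⊗ a g w) (trans (+-congˡ (∑-zero (splits⁺ w) _ λ t∈ →
           trans (*-congˡ (g-short (splits⁺-length₂ w t∈))) (zeroʳ _))) (+-identityʳ _))) ⟩
    coeff a [] * coeff g w * coeff b [] ∎
    where
    g-short : ∀ {v} → length v < length w → coeff g v ≈ 0#
    g-short {v} v< = homogeneous-coeff (length w) g v hom (λ e → ℕP.<-irrefl e v<)
    ag-short : ∀ u → length u < length w → coeff (a ⊗ g) u ≈ 0#
    ag-short u u< = trans (coeff-⊗ a g u) (∑-zero (splits u) _ λ t∈ →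
      trans (*-congˡ (g-short (ℕP.≤-<-trans (splits-length₂ u t∈) u<))) (zeroʳ _))

  δFin : ∀ {r} → Fin r → Fin r → Carrier
  δFin j i = if toℕ j ℕ.≡ᵇ toℕ i then 1# else 0#

  ∑-δFin : ∀ r (j : Fin r) (X : Fin r → Carrier) → ∑[ i ← allFin r ] (δFin j i * X i) ≈ X j
  ∑-δFin (suc r) j X = trans (reflexive (Eq.cong (λ is → ∑[ i ← is ] (δFin j i * X i)) allFin-suc)) (byIndex j)
    where
    allFin-suc : allFin (suc r) ≡ Fin.zero ∷ map Fin.suc (allFin r)
    allFin-suc = Eq.cong (Fin.zero ∷_) (Eq.sym (ListP.map-tabulate (λ i → i) Fin.suc))
    byIndex : ∀ j → ∑[ i ← Fin.zero ∷ map Fin.suc (allFin r) ] (δFin j i * X i) ≈ X j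
    byIndex Fin.zero = begin
      1# * X Fin.zero + ∑ (map Fin.suc (allFin r)) (λ i → δFin Fin.zero i * X i)
        ≈⟨ +-cong (*-identityˡ _) (trans (reflexive (∑-map Fin.suc (allFin r) _)) (∑-zero (allFin r) _ λ _ → zeroˡ _)) ⟩
      X Fin.zero + 0#
        ≈⟨ +-identityʳ _ ⟩
      X Fin.zero ∎
    byIndex (Fin.suc j′) = begin
      0# * X Fin.zero + ∑ (map Fin.suc (allFin r)) (λ i → δFin (Fin.suc j′) i * X i)
        ≈⟨ +-cong (zeroˡ _) (reflexive (∑-map Fin.suc (allFin r) _)) ⟩
      0# + ∑[ i ← allFin r ] (δFin j′ i * X (Fin.suc i))
        ≈⟨ trans (+-identityˡ _) (∑-δFin r j′ (X ∘ Fin.suc)) ⟩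
      X (Fin.suc j′) ∎

  -- The coefficient of the generator i collected from a representation
  -- Σ_k a_k g_{i_k} b_k: the sum of the products of constant terms.
  idealCoefficients : ∀ {r} → List (Poly × Fin r × Poly) → Fin r → Carrier
  idealCoefficients ts i =
    ∑[ t ← ts ] (δFin (proj₁ (proj₂ t)) i * (coeff (proj₁ t) [] * coeff (proj₂ (proj₂ t)) []))

  ideal-degreePart : ∀ {r} (g g′ : Fin r → Poly) N → (∀ i → Homogeneous N (g′ i)) →
    (∀ i v → length v ≤ N → coeff (g i) v ≈ coeff (g′ i) v) →
    ∀ f (f∈ : InIdeal g f) w → length w ≡ N →
    coeff f w ≈ ∑[ i ← allFin r ] (idealCoefficients (proj₁ f∈) i * coeff (g′ i) w)
  ideal-degreePart {r} g g′ N hom g≈g′ f (ts , f≃) w Eq.refl = begin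
    coeff f w
      ≈⟨ trans (f≃ w) (coeff-sumP _ ts w) ⟩
    ∑[ t ← ts ] coeff (left t ⊗ g (index t) ⊗ right t) w
      ≈⟨ ∑-cong′ ts (λ t → trans (coeff-⊗-local (left t) _ (g′ (index t)) (right t) w (g≈g′ (index t)))
                                  (coeff-⊗-homogeneous (left t) (g′ (index t)) (right t) w (hom (index t)))) ⟩
    ∑[ t ← ts ] (coeff (left t) [] * coeff (g′ (index t)) w * coeff (right t) [])
      ≈⟨ ∑-cong′ ts (λ t → trans (xy∙z≈xz∙y _ _ _)
           (sym (∑-δFin r (index t) λ j → coeff (left t) [] * coeff (right t) [] * coeff (g′ j) w))) ⟩
    ∑[ t ← ts ] ∑[ j ← allFin r ] (δFin (index t) j * (coeff (left t) [] * coeff (right t) [] * coeff (g′ j) w))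
      ≈⟨ ∑-swap ts (allFin r) _ ⟩
    ∑[ j ← allFin r ] ∑[ t ← ts ] (δFin (index t) j * (coeff (left t) [] * coeff (right t) [] * coeff (g′ j) w))
      ≈⟨ ∑-cong′ (allFin r) (λ j → trans (∑-cong′ ts λ t → sym (*-assoc _ _ _)) (sym (∑-*ʳ _ ts _))) ⟩
    ∑[ j ← allFin r ] (idealCoefficients ts j * coeff (g′ j) w) ∎
    where
    left right : Poly × Fin r × Poly → Poly
    left t  = proj₁ t
    right t = proj₂ (proj₂ t)
    index : Poly × Fin r × Poly → Fin r
    index t = proj₁ (proj₂ t)

  coeff-combination : ∀ {r} (cs : Fin r → Carrier) (g : Fin r → Poly) w →
    coeff (sumP (map (λ i → cs i · g i) (allFin r))) w ≈ ∑[ i ← allFin r ] (cs i * coeff (g i) w)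
  coeff-combination {r} cs g w =
    trans (coeff-sumP (λ i → cs i · g i) (allFin r) w) (∑-cong′ (allFin r) λ i → coeff-· (cs i) (g i) w)

mainTheorem7 : ∀ {c ℓ : Level} (R : CommutativeRing c ℓ) → IsField R → CharZero R →
    let open CommutativeRing R using (Carrier)
        open FreeAlg R
    in (d n r : ℕ) → d ℕ.≥ 1 → (f : Poly) → IsSPoly d n f →
       (P : Fin r → Vec Poly (2 ℕ.* d)) →
       InIdeal (λ i → standard (P i)) f →
       Σ (Fin r → Carrier) λ cs →
         f ≃ sumP (List.map (λ i → cs i · standard (Vec.map (homPart 1) (P i))) (allFin r))
mainTheorem7 R isField charZero d n r _ f f-sPoly P f∈ = cs , coefficientwise
  where
  open CommutativeRing R
  open FreeAlg R
  open Development R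

  g′ : Fin r → Poly
  g′ i = standard (Vec.map (homPart 1) (P i))

  cs : Fin r → Carrier
  cs = idealCoefficients (proj₁ f∈)

  -- In characteristic 0 the element 2 is nonzero, hence invertible in a field.
  two-invertible : ∃ λ y → y * natToR R 2 ≈ 1#
  two-invertible with IsField.inverse isField (natToR R 2) (charZero 1)
  ... | y , 2y≈1 = y , trans (*-comm y _) 2y≈1

  half : ∀ x → x ≈ - x → x ≈ 0#
  half = two-invertible⇒half two-invertible

  coefficientwise : f ≃ sumP (map (λ i → cs i · g′ i) (allFin r))
  coefficientwise w with length w ℕ.≟ 2 ℕ.* d
  ... | yes ∣w∣≡2d = trans (ideal-degreePart (λ i → standard (P i)) g′ (2 ℕ.* d) (λ i → homogeneous-standard-linear (P i))
                              (λ i → standard-lowDegree half d (P i)) f f∈ w ∣w∣≡2d)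
                           (sym (coeff-combination cs g′ w))
  ... | no  ∣w∣≢2d = trans (sPoly-vanishes d n f f-sPoly w ∣w∣≢2d)
                           (sym (homogeneous-coeff (2 ℕ.* d) _ w (homogeneous-sumP _ (allFin r)
                             λ {i} _ → homogeneous-· (cs i) (g′ i) (homogeneous-standard-linear (P i))) ∣w∣≢2d))
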